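{- Consider a run of algorithm LMA on an Exponential Caching input all of whose requested sets have cardinality at most $r$, with a fixed valid comparison partitioning $p^*$. Whenever LMA executes fetch$(z)$ inside its final while loop (i.e., for an element $z$ with $b(z)\ge 2^{p(z)}$), it holds that $\mathbf E[\Delta\mathrm{LMA}+\Delta\Phi]\le 0$, where $\Delta\mathrm{LMA}$ is the movement cost charged to this fetch, $\Delta\Phi$ the resulting change of $\Phi=\sum_{u\in U}\Phi_u$, and the expectation is over the random choices of this fetch.
   Context: Exponential Caching: $|U|=2^w-1$; with $[w]=\{0,\dots,w-1\}$, a partitioning $p:U\to[w]$ is valid if $|p^{ -1}(i)|=2^i$; chunks $S_i=p^{ -1}(i)$. LMA maintains a valid partitioning $p$ and budgets $b(z)$, initially $0$. fetch$(z)$: if $\ell=p(z)>0$, for $i=0,\dots,\ell-1$ pick $a_i$ uniformly at random from $S_i$, then move $z$ from $S_\ell$ to $S_0$ and each $a_i$ from $S_i$ to $S_{i+1}$; in all cases set $b(z)\gets0$; the movement cost charged to it is $2^\ell+\sum_{i=0}^{\ell-1}2^{i+1}$ if $\ell>0$, and $0$ otherwise. On request $R$: let $x\in R$ minimize $p(x)$, $\ell=p(x)$ (at the time of the request); pay access cost $2^\ell$; execute fetch$(x)$; for each $y\in R\setminus\{x\}$ set $b(y)\gets b(y)+2^\ell$; then while some $z$ has $b(z)\ge 2^{p(z)}$, execute fetch$(z)$. Potential: $\alpha=7$, $\gamma=7r-6$, $\beta=21r-11$, $\kappa=\lceil\log_2\beta\rceil$; $\Phi_u=\alpha\,b(u)$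 if $p(u)\le p^*(u)+\kappa$, and $\Phi_u=\beta\,2^{p(u)}-\gamma\,b(u)$ if $p(u)\ge p^*(u)+\kappa+1$. -}

module Defs where

open import Data.Nat as ℕ using (ℕ; zero; suc; _^_; _∸_; _<_; _≤_; _≤?_)
open import Data.Nat.Logarithm using (⌈log₂_⌉)
open import Data.Fin using (Fin; _≟_)
open import Data.Bool using (Bool; if_then_else_; _∧_; not)
open import Data.List using (List; []; _∷_; length; filter; map; concatMap; allFin; _∷ʳ_; foldr; upTo)
open import Data.Nat.ListAction using (sum)
open import Data.List.Membership.Propositional using (_∈_)
open import Data.List.Relation.Unary.Any using (any?)
open import Data.List.Relation.Unary.Unique.Propositional using (Unique)
open import Data.Integer as ℤ using (ℤ; +_)
open import Data.Rational.Unnormalised using (ℚᵘ; mkℚᵘ; 0ℚᵘ)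
open import Data.Product using (_×_)
open import Relation.Nullary using (yes; no)
open import Relation.Nullary.Decidable using (⌊_⌋)
open import Relation.Binary.PropositionalEquality using (_≡_)

U : ℕ → Set
U w = Fin (2 ^ w ∸ 1)

Partition : ℕ → Set
Partition w = U w → ℕ

chunk : ∀ {w} → Partition w → ℕ → List (U w)
chunk {w} p i = filter (λ u → p u ℕ.≟ i) (allFin (2 ^ w ∸ 1))

Valid : (w : ℕ) → Partition w → Set
Valid w p = (∀ u → p u < w) × (∀ i → i < w → length (chunk {w} p i) ≡ 2 ^ i)

record State (w : ℕ) : Set where
  constructor ⟨_,_⟩
  field
    p : Partition w
    b : U w → ℕ
open State public

-- All possible outcomes (a_0, …, a_{k-1}) of the random choices with a_i ∈ S_i.
-- Each outcome appears exactly once; independent uniform choices make all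
-- outcomes equally likely.
choices : ∀ {w} → Partition w → ℕ → List (List (U w))
choices p zero = [] ∷ []
choices {w} p (suc k) = concatMap (λ as → map (λ u → as ∷ʳ u) (chunk {w} p k)) (choices {w} p k)

member : ∀ {w} → U w → List (U w) → Bool
member {w} u as = ⌊ any? (_≟_ {2 ^ w ∸ 1} u) as ⌋

fetch : ∀ {w} → State w → U w → List (U w) → State w
fetch {w} s z as =
  ⟨ (λ u → if ⌊ u ≟ z ⌋ then 0 else (if member {w} u as then suc (p s u) else p s u))
  , (λ u → if ⌊ u ≟ z ⌋ then 0 else b s u) ⟩

movementCost : ℕ → ℕ
movementCost zero = 0
movementCost (suc k) = 2 ^ suc k ℕ.+ sum (map (λ i → 2 ^ suc i) (upTo (suc k)))

-- State after the non-loop part of serving request R with minimiser x and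
-- choices as: fetch(x), then b(y) += 2^ℓ for y ∈ R \ {x}, ℓ = p(x) before.
serveRequest : ∀ {w} → State w → List (U w) → U w → List (U w) → State w
serveRequest {w} s R x as =
  ⟨ p (fetch s x as)
  , (λ y → b (fetch s x as) y ℕ.+
        (if member {w} y R ∧ not ⌊ y ≟ x ⌋ then 2 ^ p s x else 0)) ⟩

-- Reachable configurations of LMA on inputs whose requests have size ≤ r.
-- Idle s   : state s between requests (while loop finished).
-- InLoop s : state s at which the final while loop is (re)checking its condition.
mutual
  data Idle (w r : ℕ) : State w → Set where
    start : (p₀ : Partition w) → Valid w p₀ → Idle w r ⟨ p₀ , (λ _ → 0) ⟩
    exit  : ∀ {s} → InLoop w r s → (∀ z → b s z < 2 ^ p s z) → Idle w r s

  data InLoop (w r : ℕ) : State w → Set where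
    request : ∀ {s} → Idle w r s →
              (R : List (U w)) → Unique R → length R ≤ r →
              (x : U w) → x ∈ R → (∀ {y} → y ∈ R → p s x ≤ p s y) →
              (as : List (U w)) → as ∈ choices {w} (p s) (p s x) →
              InLoop w r (serveRequest s R x as)
    loop    : ∀ {s} → InLoop w r s →
              (z : U w) → 2 ^ p s z ≤ b s z →
              (as : List (U w)) → as ∈ choices {w} (p s) (p s z) →
              InLoop w r (fetch s z as)

α : ℤ
α = + 7

γ : ℕ → ℤ
γ r = + (7 ℕ.* r) ℤ.- + 6

β : ℕ → ℤ
β r = + (21 ℕ.* r) ℤ.- + 11

κ : ℕ → ℕ
κ r = ⌈log₂ (21 ℕ.* r ∸ 11) ⌉

Φu : ∀ {w} → (r : ℕ) → (pstar : Partition w) → State w → U w → ℤ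
Φu r pstar s u with p s u ≤? pstar u ℕ.+ κ r
... | yes _ = α ℤ.* + b s u
... | no  _ = β r ℤ.* + (2 ^ p s u) ℤ.- γ r ℤ.* + b s u

sumℤ : List ℤ → ℤ
sumℤ = foldr ℤ._+_ (+ 0)

Φ : ∀ {w} → (r : ℕ) → (pstar : Partition w) → State w → ℤ
Φ {w} r pstar s = sumℤ (map (Φu r pstar s) (allFin (2 ^ w ∸ 1)))

mean : List ℤ → ℚᵘ
mean [] = 0ℚᵘ
mean (x ∷ xs) = mkℚᵘ (sumℤ (x ∷ xs)) (length xs)

deltaFetch : ∀ {w} → (r : ℕ) → Partition w → State w → U w → List (U w) → ℤ
deltaFetch r pstar s z as =
  + movementCost (p s z) ℤ.+ (Φ r pstar (fetch s z as) ℤ.- Φ r pstar s)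

expectedDelta : ∀ {w} → (r : ℕ) → Partition w → State w → U w → ℚᵘ
expectedDelta {w} r pstar s z = mean (map (deltaFetch r pstar s z) (choices {w} (p s) (p s z)))

module Submission where

open import Defs
open import Data.Bool using (true; false; if_then_else_; _∧_)
open import Data.Bool.Properties using (∧-zeroʳ)
open import Data.Fin using (Fin; _≟_)
import Data.Fin as Fin
open import Data.List using (List; []; _∷_; _∷ʳ_; _++_; length; map; filter; allFin; concatMap; upTo)
open import Data.List.Properties using (map-∘; map-++; map-tabulate; applyUpTo-∷ʳ)
open import Data.List.Membership.Propositional using (_∈_; _∉_; find)
import Data.List.Membership.DecPropositional as DecMembership
open import Data.List.Membership.Propositional.Properties
  using (∈-filter⁻; ∈-concatMap⁻; ∈-map⁻; ∈-++⁻; ∈-++⁺ˡ; ∈-++⁺ʳ)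
open import Data.List.Relation.Unary.Any using (here; there)
open import Data.Nat as ℕ using (ℕ; zero; suc; _+_; _*_; _^_; _∸_; _≤_; _<_; _≤?_; _<?_; z≤n; s≤s)
open import Data.Nat.Properties hiding (_≟_)
open import Algebra.Properties.CommutativeSemigroup +-commutativeSemigroup using (interchange)
open import Data.Nat.ListAction using (sum)
open import Data.Nat.ListAction.Properties using (sum-++)
open import Data.Product using (_×_; _,_; ∃₂; proj₁; proj₂)
open import Data.Sum using (inj₁; inj₂)
open import Function using (case_of_)
open import Induction.WellFounded using (Acc; acc)
open import Data.Nat.Induction using (<-wellFounded)
open import Data.Nat.Logarithm using (⌈log₂_⌉)
open import Data.Nat.Logarithm.Core using (⌈log2⌉)
open import Relation.Binary.Definitions using (tri<; tri≈; tri>)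
open import Relation.Binary.PropositionalEquality
open import Relation.Nullary using (Dec; yes; no; does; ¬_; contradiction)
open import Relation.Nullary.Decidable using (⌊_⌋; isYes≗does; dec-true; dec-false)

-- Amortised analysis of one fetch of the while loop, with ℓ = p z.  Every state inside the loop
-- keeps p valid and b u < 2^(p u + 1): a request raises b y by 2^(p x) ≤ 2^(p y).  Hence
-- 2^ℓ ≤ b z < 2^(ℓ+1), and moving z to S₀ with budget 0 frees at least 7·2^ℓ of potential:
-- α·b z ≥ 7·2^ℓ if z is low, (β - 2γ)·2^ℓ ≥ 7·2^ℓ if it is high.  The movement cost is at most
-- 3·2^ℓ.  Promoting a_i from S_i to S_{i+1} costs at most β·2^(i+1) of potential, and only when
-- p* a_i + κ ≤ i; fewer than 2^(i+1-κ) ≤ 2^(i+1)/β elements qualify, and a_i is uniform in S_i of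
-- size 2^i, so the expected increase is at most 4·2^i, summing to at most 4·2^ℓ over i < ℓ.
-- Altogether E[ΔLMA + ΔΦ] ≤ 3·2^ℓ + 4·2^ℓ - 7·2^ℓ = 0.

private variable A B : Set

∑ : List A → (A → ℕ) → ℕ
∑ xs f = sum (map f xs)

𝟙 : {P : Set} → Dec P → ℕ
𝟙 P? = if does P? then 1 else 0

∑-cong : (xs : List A) {f g : A → ℕ} → (∀ x → f x ≡ g x) → ∑ xs f ≡ ∑ xs g
∑-cong []       f≗g = refl
∑-cong (x ∷ xs) f≗g = cong₂ _+_ (f≗g x) (∑-cong xs f≗g)

∑-mono-≤ : (xs : List A) {f g : A → ℕ} → (∀ x → f x ≤ g x) → ∑ xs f ≤ ∑ xs g
∑-mono-≤ []       f≤g = z≤n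
∑-mono-≤ (x ∷ xs) f≤g = +-mono-≤ (f≤g x) (∑-mono-≤ xs f≤g)

∑-+ : (xs : List A) (f g : A → ℕ) → ∑ xs (λ x → f x + g x) ≡ ∑ xs f + ∑ xs g
∑-+ []       f g = refl
∑-+ (x ∷ xs) f g = begin
  f x + g x + ∑ xs (λ x → f x + g x) ≡⟨ cong (f x + g x +_) (∑-+ xs f g) ⟩
  f x + g x + (∑ xs f + ∑ xs g)      ≡⟨ interchange (f x) (g x) (∑ xs f) (∑ xs g) ⟩
  f x + ∑ xs f + (g x + ∑ xs g)      ∎
  where open ≡-Reasoning

∑-*ˡ : (xs : List A) (c : ℕ) (f : A → ℕ) → ∑ xs (λ x → c * f x) ≡ c * ∑ xs f
∑-*ˡ []       c f = sym (*-zeroʳ c)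
∑-*ˡ (x ∷ xs) c f = trans (cong (c * f x +_) (∑-*ˡ xs c f)) (sym (*-distribˡ-+ c (f x) (∑ xs f)))

∑-const : (xs : List A) (c : ℕ) → ∑ xs (λ _ → c) ≡ length xs * c
∑-const []       c = refl
∑-const (x ∷ xs) c = cong (c +_) (∑-const xs c)

∑-zero : (xs : List A) → ∑ xs (λ _ → 0) ≡ 0
∑-zero xs = trans (∑-const xs 0) (*-zeroʳ (length xs))

∑-++ : (xs ys : List A) (f : A → ℕ) → ∑ (xs ++ ys) f ≡ ∑ xs f + ∑ ys f
∑-++ xs ys f = trans (cong sum (map-++ f xs ys)) (sum-++ (map f xs) (map f ys))

∑-concatMap : (g : A → List B) (xs : List A) (f : B → ℕ) →
              ∑ (concatMap g xs) f ≡ ∑ xs (λ x → ∑ (g x) f)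
∑-concatMap g []       f = refl
∑-concatMap g (x ∷ xs) f = trans (∑-++ (g x) (concatMap g xs) f) (cong (∑ (g x) f +_) (∑-concatMap g xs f))

∑-map : (h : A → B) (xs : List A) (f : B → ℕ) → ∑ (map h xs) f ≡ ∑ xs (λ x → f (h x))
∑-map h xs f = sym (cong sum (map-∘ {g = f} {f = h} xs))

length≡∑1 : (xs : List A) → length xs ≡ ∑ xs (λ _ → 1)
length≡∑1 xs = sym (trans (∑-const xs 1) (*-identityʳ (length xs)))

module _ {A : Set} {P : A → Set} (P? : (x : A) → Dec (P x)) where

  length-filter≡∑𝟙 : (xs : List A) → length (filter P? xs) ≡ ∑ xs (λ x → 𝟙 (P? x))
  length-filter≡∑𝟙 []       = refl
  length-filter≡∑𝟙 (x ∷ xs) with does (P? x)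
  ... | true  = cong suc (length-filter≡∑𝟙 xs)
  ... | false = length-filter≡∑𝟙 xs

  ∑-filter-≤ : (xs : List A) {f g : A → ℕ} → (∀ x → P x → f x ≤ g x) → ∑ (filter P? xs) f ≤ ∑ xs g
  ∑-filter-≤ []       f≤g = z≤n
  ∑-filter-≤ (x ∷ xs) {f} {g} f≤g with P? x
  ... | yes px = +-mono-≤ (f≤g x px) (∑-filter-≤ xs f≤g)
  ... | no  _  = ≤-trans (∑-filter-≤ xs f≤g) (m≤n+m _ (g x))

𝟙-yes : {P : Set} (P? : Dec P) → P → 𝟙 P? ≡ 1
𝟙-yes P? p rewrite dec-true P? p = refl

𝟙-no : {P : Set} (P? : Dec P) → ¬ P → 𝟙 P? ≡ 0
𝟙-no P? ¬p rewrite dec-false P? ¬p = refl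

𝟙-mono : {P Q : Set} (P? : Dec P) (Q? : Dec Q) → (P → Q) → 𝟙 P? ≤ 𝟙 Q?
𝟙-mono (yes p) Q? P⇒Q = ≤-reflexive (sym (𝟙-yes Q? (P⇒Q p)))
𝟙-mono (no  _) Q? P⇒Q = z≤n

𝟙[<1+m] : ∀ n m → 𝟙 (n <? suc m) ≡ 𝟙 (n <? m) + 𝟙 (n ℕ.≟ m)
𝟙[<1+m] n m with <-cmp n m
... | tri< n<m _ _ = trans (𝟙-yes (n <? suc m) (m<n⇒m<1+n n<m))
                           (sym (cong₂ _+_ (𝟙-yes (n <? m) n<m) (𝟙-no (n ℕ.≟ m) (<⇒≢ n<m))))
... | tri≈ _ n≡m _ = trans (𝟙-yes (n <? suc m) (s≤s (≤-reflexive n≡m)))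
                           (sym (cong₂ _+_ (𝟙-no (n <? m) (λ n<m → <-irrefl n≡m n<m)) (𝟙-yes (n ℕ.≟ m) n≡m)))
... | tri> _ _ m<n = trans (𝟙-no (n <? suc m) (λ n<1+m → <-irrefl refl (<-≤-trans m<n (ℕ.s≤s⁻¹ n<1+m))))
                           (sym (cong₂ _+_ (𝟙-no (n <? m) (<-asym m<n)) (𝟙-no (n ℕ.≟ m) (λ n≡m → <-irrefl (sym n≡m) m<n))))

∑-allFin-suc : (n : ℕ) (f : Fin (suc n) → ℕ) → ∑ (allFin (suc n)) f ≡ f Fin.zero + ∑ (allFin n) (λ u → f (Fin.suc u))
∑-allFin-suc n f = cong (f Fin.zero +_)
  (trans (cong sum (map-tabulate Fin.suc f)) (sym (cong sum (map-tabulate (λ u → u) (λ u → f (Fin.suc u))))))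

∑-allFin-at : (n : ℕ) (a : Fin n) (f : Fin n → ℕ) → ∑ (allFin n) (λ u → if does (u ≟ a) then f u else 0) ≡ f a
∑-allFin-at (suc n) Fin.zero    f = begin
  ∑ (allFin (suc n)) (λ u → if does (u ≟ Fin.zero) then f u else 0)
    ≡⟨ ∑-allFin-suc n (λ u → if does (u ≟ Fin.zero) then f u else 0) ⟩
  f Fin.zero + ∑ (allFin n) (λ _ → 0) ≡⟨ cong (f Fin.zero +_) (∑-zero (allFin n)) ⟩
  f Fin.zero + 0                      ≡⟨ +-identityʳ _ ⟩
  f Fin.zero                          ∎
  where open ≡-Reasoning
∑-allFin-at (suc n) (Fin.suc a) f =
  trans (∑-allFin-suc n (λ u → if does (u ≟ Fin.suc a) then f u else 0)) (∑-allFin-at n a (λ u → f (Fin.suc u)))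

∉-∷ʳ : {x y : A} {xs : List A} → x ∉ xs → x ≢ y → x ∉ xs ∷ʳ y
∉-∷ʳ {xs = xs} x∉xs x≢y x∈xs∷ʳy with ∈-++⁻ xs x∈xs∷ʳy
... | inj₁ x∈xs       = x∉xs x∈xs
... | inj₂ (here x≡y) = x≢y x≡y

⌊⌋-true : {P : Set} (P? : Dec P) → P → ⌊ P? ⌋ ≡ true
⌊⌋-true P? p = trans (isYes≗does P?) (dec-true P? p)

⌊⌋-false : {P : Set} (P? : Dec P) → ¬ P → ⌊ P? ⌋ ≡ false
⌊⌋-false P? ¬p = trans (isYes≗does P?) (dec-false P? ¬p)

+-cancel-chain : ∀ x y c {s t d} → x + s ≡ y + t → y + d ≡ c + s → x + d ≡ c + t
+-cancel-chain x y c {s} {t} {d} x+s≡y+t y+d≡c+s = +-cancelʳ-≡ s (x + d) (c + t) (begin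
  x + d + s ≡⟨ +-comm-right x d s ⟩
  x + s + d ≡⟨ cong (_+ d) x+s≡y+t ⟩
  y + t + d ≡⟨ +-comm-right y t d ⟩
  y + d + t ≡⟨ cong (_+ t) y+d≡c+s ⟩
  c + s + t ≡⟨ +-comm-right c s t ⟩
  c + t + s ∎)
  where
  open ≡-Reasoning
  +-comm-right : ∀ a b e → a + b + e ≡ a + e + b
  +-comm-right a b e = trans (+-assoc a b e) (trans (cong (a +_) (+-comm b e)) (sym (+-assoc a e b)))

2^n+2^n≡2^[1+n] : ∀ n → 2 ^ n + 2 ^ n ≡ 2 ^ suc n
2^n+2^n≡2^[1+n] n = cong (2 ^ n +_) (sym (+-identityʳ (2 ^ n)))

∑2^[1+i]≤2^[1+n] : ∀ n → ∑ (upTo n) (λ i → 2 ^ suc i) ≤ 2 ^ suc n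
∑2^[1+i]≤2^[1+n] zero    = z≤n
∑2^[1+i]≤2^[1+n] (suc n) = begin
  ∑ (upTo (suc n)) (λ i → 2 ^ suc i)                   ≡⟨ cong (λ is → ∑ is (λ i → 2 ^ suc i)) (applyUpTo-∷ʳ (λ i → i) n) ⟨
  ∑ (upTo n ∷ʳ n) (λ i → 2 ^ suc i)                     ≡⟨ ∑-++ (upTo n) (n ∷ []) (λ i → 2 ^ suc i) ⟩
  ∑ (upTo n) (λ i → 2 ^ suc i) + (2 ^ suc n + 0)        ≤⟨ +-monoˡ-≤ (2 ^ suc n + 0) (∑2^[1+i]≤2^[1+n] n) ⟩
  2 ^ suc (suc n)                                       ∎
  where open ≤-Reasoning

movementCost≤3*2^ℓ : ∀ ℓ → movementCost ℓ ≤ 3 * 2 ^ ℓ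
movementCost≤3*2^ℓ zero    = z≤n
movementCost≤3*2^ℓ (suc ℓ) = +-monoʳ-≤ (2 ^ suc ℓ) (∑2^[1+i]≤2^[1+n] (suc ℓ))

n≤2^⌈log₂n⌉ : ∀ n → n ≤ 2 ^ ⌈log₂ n ⌉
n≤2^⌈log₂n⌉ n = bound n (<-wellFounded n)
  where
  bound : ∀ n (acc : Acc _<_ n) → n ≤ 2 ^ ⌈log2⌉ n acc
  bound zero          _        = z≤n
  bound (suc zero)    _        = s≤s z≤n
  bound (suc (suc n)) (acc rs) = begin
    suc (suc n)               ≤⟨ s≤s (s≤s (≤-trans (≤-reflexive (sym (⌊n/2⌋+⌈n/2⌉≡n n)))
                                                    (+-monoˡ-≤ ⌈n/2⌉ (⌊n/2⌋≤⌈n/2⌉ n)))) ⟩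
    suc (suc (⌈n/2⌉ + ⌈n/2⌉)) ≡⟨ cong suc (+-suc ⌈n/2⌉ ⌈n/2⌉) ⟨
    suc ⌈n/2⌉ + suc ⌈n/2⌉     ≤⟨ +-mono-≤ ih (≤-trans ih (≤-reflexive (sym (+-identityʳ _)))) ⟩
    2 ^ suc (⌈log2⌉ (suc ⌈n/2⌉) _) ∎
    where
    open ≤-Reasoning
    ⌈n/2⌉ = ℕ.⌈ n /2⌉
    ih = bound (suc ⌈n/2⌉) (rs (⌈n/2⌉<n n))

module _ {w : ℕ} where

  open DecMembership (_≟_ {2 ^ w ∸ 1}) using (_∈?_)

  private
    elements : List (U w)
    elements = allFin (2 ^ w ∸ 1)

  member-true : {u : U w} {as : List (U w)} → u ∈ as → member {w} u as ≡ true
  member-true {u} {as} = ⌊⌋-true (u ∈? as)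

  member-false : {u : U w} {as : List (U w)} → u ∉ as → member {w} u as ≡ false
  member-false {u} {as} = ⌊⌋-false (u ∈? as)

  ∈-chunk⁻ : {q : Partition w} {k : ℕ} {a : U w} → a ∈ chunk {w} q k → q a ≡ k
  ∈-chunk⁻ {q} {k} a∈S = proj₂ (∈-filter⁻ (λ u → q u ℕ.≟ k) {xs = elements} a∈S)

  chunk-length-update : (q q′ : Partition w) (a : U w) {v v′ : ℕ} → (∀ u → u ≢ a → q′ u ≡ q u) →
                        q a ≡ v → q′ a ≡ v′ → ∀ i →
                        length (chunk {w} q′ i) + 𝟙 (v ℕ.≟ i) ≡ length (chunk {w} q i) + 𝟙 (v′ ℕ.≟ i)
  chunk-length-update q q′ a q′≗q refl refl i = begin
    length (chunk {w} q′ i) + 𝟙 (q a ℕ.≟ i)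
      ≡⟨ cong₂ _+_ (length-filter≡∑𝟙 _ elements) (sym (∑-allFin-at _ a (λ u → 𝟙 (q u ℕ.≟ i)))) ⟩
    ∑ elements (λ u → 𝟙 (q′ u ℕ.≟ i)) + ∑ elements (λ u → if does (u ≟ a) then 𝟙 (q u ℕ.≟ i) else 0)
      ≡⟨ sym (∑-+ elements _ _) ⟩
    ∑ elements (λ u → 𝟙 (q′ u ℕ.≟ i) + (if does (u ≟ a) then 𝟙 (q u ℕ.≟ i) else 0))
      ≡⟨ ∑-cong elements exchange ⟩
    ∑ elements (λ u → 𝟙 (q u ℕ.≟ i) + (if does (u ≟ a) then 𝟙 (q′ u ℕ.≟ i) else 0))
      ≡⟨ ∑-+ elements _ _ ⟩
    ∑ elements (λ u → 𝟙 (q u ℕ.≟ i)) + ∑ elements (λ u → if does (u ≟ a) then 𝟙 (q′ u ℕ.≟ i) else 0)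
      ≡⟨ cong₂ _+_ (sym (length-filter≡∑𝟙 _ elements)) (∑-allFin-at _ a (λ u → 𝟙 (q′ u ℕ.≟ i))) ⟩
    length (chunk {w} q i) + 𝟙 (q′ a ℕ.≟ i) ∎
    where
    open ≡-Reasoning
    exchange : ∀ u → 𝟙 (q′ u ℕ.≟ i) + (if does (u ≟ a) then 𝟙 (q u ℕ.≟ i) else 0)
                   ≡ 𝟙 (q u ℕ.≟ i) + (if does (u ≟ a) then 𝟙 (q′ u ℕ.≟ i) else 0)
    exchange u with u ≟ a
    ... | yes refl = +-comm (𝟙 (q′ u ℕ.≟ i)) (𝟙 (q u ℕ.≟ i))
    ... | no u≢a   = cong (λ v → 𝟙 (v ℕ.≟ i) + 0) (q′≗q u u≢a)

  module _ {q : Partition w} where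

    ∈-choices-suc⁻ : ∀ {k as} → as ∈ choices {w} q (suc k) →
                     ∃₂ λ as′ a → as′ ∈ choices {w} q k × a ∈ chunk {w} q k × as ≡ as′ ∷ʳ a
    ∈-choices-suc⁻ {k} as∈C
      with find (∈-concatMap⁻ (λ as′ → map (as′ ∷ʳ_) (chunk {w} q k)) {xs = choices {w} q k} as∈C)
    ... | as′ , as′∈C , as∈map with ∈-map⁻ (as′ ∷ʳ_) as∈map
    ...   | a , a∈S , refl = as′ , a , as′∈C , a∈S , refl

    ∈-choice⇒< : ∀ {k as u} → as ∈ choices {w} q k → u ∈ as → q u < k
    ∈-choice⇒< {zero} (here refl) ()
    ∈-choice⇒< {suc k} as∈C u∈as with ∈-choices-suc⁻ as∈C
    ... | as′ , a , as′∈C , a∈S , refl with ∈-++⁻ as′ u∈as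
    ...   | inj₁ u∈as′       = m<n⇒m<1+n (∈-choice⇒< as′∈C u∈as′)
    ...   | inj₂ (here refl) = ≤-reflexive (cong suc (∈-chunk⁻ a∈S))

    ∑-choices-suc : ∀ k (f : List (U w) → ℕ) →
                    ∑ (choices {w} q (suc k)) f ≡ ∑ (choices {w} q k) (λ as → ∑ (chunk {w} q k) (λ a → f (as ∷ʳ a)))
    ∑-choices-suc k f = trans (∑-concatMap _ (choices {w} q k) f) (∑-cong (choices {w} q k) (λ as → ∑-map _ (chunk {w} q k) f))

    length-choices-suc : ∀ k → length (choices {w} q (suc k)) ≡ length (choices {w} q k) * length (chunk {w} q k)
    length-choices-suc k = begin
      length (choices {w} q (suc k))            ≡⟨ length≡∑1 (choices {w} q (suc k)) ⟩
      ∑ (choices {w} q (suc k)) (λ _ → 1)       ≡⟨ ∑-choices-suc k (λ _ → 1) ⟩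
      ∑ C (λ _ → ∑ S (λ _ → 1))                 ≡⟨ ∑-cong C (λ _ → sym (length≡∑1 S)) ⟩
      ∑ C (λ _ → length S)                      ≡⟨ ∑-const C (length S) ⟩
      length C * length S                       ∎
      where
      open ≡-Reasoning
      C = choices {w} q k
      S = chunk {w} q k

  ∑𝟙[<m]≤2^m : (q : Partition w) → Valid w q → ∀ {m} → m ≤ w → ∑ elements (λ u → 𝟙 (q u <? m)) ≤ 2 ^ m
  ∑𝟙[<m]≤2^m q valid {zero}  _     = ≤-trans (≤-reflexive (∑-zero elements)) z≤n
  ∑𝟙[<m]≤2^m q valid {suc m} 1+m≤w = begin
    ∑ elements (λ u → 𝟙 (q u <? suc m))                     ≡⟨ ∑-cong elements (λ u → 𝟙[<1+m] (q u) m) ⟩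
    ∑ elements (λ u → 𝟙 (q u <? m) + 𝟙 (q u ℕ.≟ m))          ≡⟨ ∑-+ elements _ _ ⟩
    ∑ elements (λ u → 𝟙 (q u <? m)) + ∑ elements (λ u → 𝟙 (q u ℕ.≟ m))
      ≡⟨ cong (∑ elements (λ u → 𝟙 (q u <? m)) +_) (trans (sym (length-filter≡∑𝟙 _ elements)) (proj₂ valid m 1+m≤w)) ⟩
    ∑ elements (λ u → 𝟙 (q u <? m)) + 2 ^ m                  ≤⟨ +-monoˡ-≤ (2 ^ m) (∑𝟙[<m]≤2^m q valid (<⇒≤ 1+m≤w)) ⟩
    2 ^ m + 2 ^ m                                             ≡⟨ 2^n+2^n≡2^[1+n] m ⟩
    2 ^ suc m                                                 ∎
    where open ≤-Reasoning

  ∑-member-≤ : (f : U w → ℕ) (xs : List (U w)) → ∑ elements (λ u → if member {w} u xs then f u else 0) ≤ ∑ xs f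
  ∑-member-≤ f []       = ≤-reflexive (∑-zero elements)
  ∑-member-≤ f (x ∷ xs) = begin
    ∑ elements (λ u → if member {w} u (x ∷ xs) then f u else 0)
      ≤⟨ ∑-mono-≤ elements (λ u → split u (u ∈? x ∷ xs)) ⟩
    ∑ elements (λ u → (if does (u ≟ x) then f u else 0) + (if member {w} u xs then f u else 0))
      ≡⟨ ∑-+ elements _ _ ⟩
    ∑ elements (λ u → if does (u ≟ x) then f u else 0) + ∑ elements (λ u → if member {w} u xs then f u else 0)
      ≤⟨ +-mono-≤ (≤-reflexive (∑-allFin-at _ x f)) (∑-member-≤ f xs) ⟩
    f x + ∑ xs f ∎
    where
    open ≤-Reasoning
    split : ∀ u → Dec (u ∈ x ∷ xs) →
            (if member {w} u (x ∷ xs) then f u else 0) ≤ (if does (u ≟ x) then f u else 0) + (if member {w} u xs then f u else 0)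
    split u (yes (here refl))   rewrite member-true {u} {x ∷ xs} (here refl) | dec-true (u ≟ u) refl = m≤m+n (f u) _
    split u (yes (there u∈xs)) rewrite member-true {u} {x ∷ xs} (there u∈xs) | member-true u∈xs = m≤n+m (f u) _
    split u (no  u∉x∷xs)       rewrite member-false u∉x∷xs = z≤n

  -- Averages are multiplied out by the number of outcomes: if f averages at most c·2^i over each S_i
  -- with i < k, then ∑ as f averages at most c·2^k over the independent uniform choices.
  ∑-choices-∑≤ : (q : Partition w) (f : U w → ℕ) (c : ℕ) → ∀ k →
                 (∀ i → i < k → ∑ (chunk {w} q i) f ≤ length (chunk {w} q i) * (c * 2 ^ i)) →
                 ∑ (choices {w} q k) (λ as → ∑ as f) ≤ length (choices {w} q k) * (c * 2 ^ k)
  ∑-choices-∑≤ q f c zero    _     = z≤n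
  ∑-choices-∑≤ q f c (suc k) chunk≤ = begin
    ∑ (choices {w} q (suc k)) (λ as → ∑ as f)
      ≡⟨ ∑-choices-suc k (λ as → ∑ as f) ⟩
    ∑ C (λ as → ∑ S (λ a → ∑ (as ∷ʳ a) f))
      ≡⟨ ∑-cong C (λ as → ∑-cong S (λ a → trans (∑-++ as (a ∷ []) f) (cong (∑ as f +_) (+-identityʳ (f a))))) ⟩
    ∑ C (λ as → ∑ S (λ a → ∑ as f + f a))
      ≡⟨ ∑-cong C (λ as → trans (∑-+ S _ f) (cong (_+ ∑ S f) (∑-const S (∑ as f)))) ⟩
    ∑ C (λ as → length S * ∑ as f + ∑ S f)
      ≡⟨ trans (∑-+ C _ _) (cong₂ _+_ (∑-*ˡ C (length S) _) (∑-const C (∑ S f))) ⟩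
    length S * ∑ C (λ as → ∑ as f) + length C * ∑ S f
      ≤⟨ +-mono-≤ (*-monoʳ-≤ (length S) (∑-choices-∑≤ q f c k (λ i i<k → chunk≤ i (m<n⇒m<1+n i<k))))
                  (*-monoʳ-≤ (length C) (chunk≤ k ≤-refl)) ⟩
    length S * (length C * (c * 2 ^ k)) + length C * (length S * (c * 2 ^ k))
      ≡⟨ collect (length S) (length C) c (2 ^ k) ⟩
    length C * length S * (c * 2 ^ suc k)
      ≡⟨ cong (_* (c * 2 ^ suc k)) (length-choices-suc k) ⟨
    length (choices {w} q (suc k)) * (c * 2 ^ suc k) ∎
    where
    open ≤-Reasoning
    open import Data.Nat.Tactic.RingSolver using (solve-∀)
    C = choices {w} q k
    S = chunk {w} q k
    collect : ∀ l n c x → l * (n * (c * x)) + n * (l * (c * x)) ≡ n * l * (c * (2 * x))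
    collect = solve-∀

  module _ (s : State w) (z : U w) where

    fetch-p-self : ∀ as → p (fetch s z as) z ≡ 0
    fetch-p-self as rewrite ⌊⌋-true (z ≟ z) refl = refl

    fetch-b-self : ∀ as → b (fetch s z as) z ≡ 0
    fetch-b-self as rewrite ⌊⌋-true (z ≟ z) refl = refl

    fetch-p-∈ : ∀ {as u} → u ≢ z → u ∈ as → p (fetch s z as) u ≡ suc (p s u)
    fetch-p-∈ {as} {u} u≢z u∈as rewrite ⌊⌋-false (u ≟ z) u≢z | member-true u∈as = refl

    fetch-p-∉ : ∀ {as u} → u ≢ z → u ∉ as → p (fetch s z as) u ≡ p s u
    fetch-p-∉ {as} {u} u≢z u∉as rewrite ⌊⌋-false (u ≟ z) u≢z | member-false u∉as = refl

    fetch-b-≢ : ∀ {as u} → u ≢ z → b (fetch s z as) u ≡ b s u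
    fetch-b-≢ {as} {u} u≢z rewrite ⌊⌋-false (u ≟ z) u≢z = refl

    fetch-p-≥ : ∀ {as u} → u ≢ z → p s u ≤ p (fetch s z as) u
    fetch-p-≥ {as} {u} u≢z = case u ∈? as of λ where
      (yes u∈as) → ≤-trans (n≤1+n (p s u)) (≤-reflexive (sym (fetch-p-∈ u≢z u∈as)))
      (no  u∉as) → ≤-reflexive (sym (fetch-p-∉ u≢z u∉as))

    fetch-∷ʳ-≢ : ∀ {as a u} → u ≢ a → p (fetch s z (as ∷ʳ a)) u ≡ p (fetch s z as) u
    fetch-∷ʳ-≢ {as} {a} {u} u≢a = case u ≟ z of λ where
      (yes refl) → trans (fetch-p-self (as ∷ʳ a)) (sym (fetch-p-self as))
      (no u≢z)   → case u ∈? as of λ where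
        (yes u∈as) → trans (fetch-p-∈ u≢z (∈-++⁺ˡ u∈as)) (sym (fetch-p-∈ u≢z u∈as))
        (no  u∉as) → trans (fetch-p-∉ u≢z (∉-∷ʳ u∉as u≢a)) (sym (fetch-p-∉ u≢z u∉as))

    -- Across the choices a₀ … a_{k-1}, the fetch takes the chunk indices p z, 0, …, k-1 off
    -- z, a₀, …, a_{k-1} and puts 0, 1, …, k on them: the chunk sizes change by 𝟙(k) - 𝟙(p z).
    fetch-chunk-length : ∀ k {as} → as ∈ choices {w} (p s) k → k ≤ p s z → ∀ i →
      length (chunk {w} (p (fetch s z as)) i) + 𝟙 (p s z ℕ.≟ i) ≡ length (chunk {w} (p s) i) + 𝟙 (k ℕ.≟ i)
    fetch-chunk-length zero (here refl) _ =
      chunk-length-update (p s) (p (fetch s z [])) z (λ u u≢z → fetch-p-∉ {as = []} u≢z (λ ())) refl (fetch-p-self [])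
    fetch-chunk-length (suc k) as∈C k<pz i with ∈-choices-suc⁻ as∈C
    ... | as′ , a , as′∈C , a∈S , refl =
      +-cancel-chain (∣S∣ (p (fetch s z (as′ ∷ʳ a)))) (∣S∣ (p (fetch s z as′))) (∣S∣ (p s))
                     (chunk-length-update (p (fetch s z as′)) (p (fetch s z (as′ ∷ʳ a))) a
                                          (λ u → fetch-∷ʳ-≢) old new i)
                     (fetch-chunk-length k as′∈C (<⇒≤ k<pz) i)
      where
      ∣S∣ : Partition w → ℕ
      ∣S∣ q = length (chunk {w} q i)
      pa≡k : p s a ≡ k
      pa≡k = ∈-chunk⁻ a∈S
      a≢z : a ≢ z
      a≢z refl = <-irrefl (sym pa≡k) k<pz
      a∉as′ : a ∉ as′
      a∉as′ a∈as′ = <-irrefl pa≡k (∈-choice⇒< as′∈C a∈as′)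
      old : p (fetch s z as′) a ≡ k
      old = trans (fetch-p-∉ a≢z a∉as′) pa≡k
      new : p (fetch s z (as′ ∷ʳ a)) a ≡ suc k
      new = trans (fetch-p-∈ a≢z (∈-++⁺ʳ as′ (here refl))) (cong suc pa≡k)

    fetch-valid : ∀ {as} → Valid w (p s) → as ∈ choices {w} (p s) (p s z) → Valid w (p (fetch s z as))
    fetch-valid {as} (p<w , |S|≡2^) as∈C = p′<w , |S′|≡2^
      where
      p′<w : ∀ u → p (fetch s z as) u < w
      p′<w u = case u ≟ z of λ where
        (yes refl) → subst (_< w) (sym (fetch-p-self as)) (≤-<-trans z≤n (p<w z))
        (no u≢z)   → case u ∈? as of λ where
          (yes u∈as) → subst (_< w) (sym (fetch-p-∈ u≢z u∈as)) (≤-<-trans (∈-choice⇒< as∈C u∈as) (p<w z))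
          (no  u∉as) → subst (_< w) (sym (fetch-p-∉ u≢z u∉as)) (p<w u)
      |S′|≡2^ : ∀ i → i < w → length (chunk {w} (p (fetch s z as)) i) ≡ 2 ^ i
      |S′|≡2^ i i<w = trans (+-cancelʳ-≡ _ _ _ (fetch-chunk-length (p s z) as∈C ≤-refl i)) (|S|≡2^ i i<w)

module _ {w r : ℕ} where

  open DecMembership (_≟_ {2 ^ w ∸ 1}) using (_∈?_)

  module _ {s : State w} {R : List (U w)} {x : U w} {as : List (U w)} where

    serveRequest-b-self : b (serveRequest s R x as) x ≡ 0
    serveRequest-b-self
      rewrite fetch-b-self s x as | ⌊⌋-true (x ≟ x) refl | ∧-zeroʳ (member {w} x R) = refl

    serveRequest-b-≢ : ∀ {y} → y ≢ x → (∀ {y} → y ∈ R → p s x ≤ p s y) →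
                       b (serveRequest s R x as) y ≤ b s y + 2 ^ p s y
    serveRequest-b-≢ {y} y≢x x-min rewrite fetch-b-≢ s x {as} y≢x | ⌊⌋-false (y ≟ x) y≢x =
      +-monoʳ-≤ (b s y) (increment (y ∈? R))
      where
      increment : Dec (y ∈ R) → (if member {w} y R ∧ true then 2 ^ p s x else 0) ≤ 2 ^ p s y
      increment (yes y∈R) rewrite member-true {w} y∈R  = ^-monoʳ-≤ 2 (x-min y∈R)
      increment (no  y∉R) rewrite member-false {w} y∉R = z≤n

  mutual

    idle-invariant : ∀ {s} → Idle w r s → Valid w (p s) × (∀ u → b s u < 2 ^ p s u)
    idle-invariant (start p₀ valid)    = valid , λ u → m^n>0 2 (p₀ u)
    idle-invariant (exit inLoop b<2^p) = proj₁ (loop-invariant inLoop) , b<2^p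

    loop-invariant : ∀ {s} → InLoop w r s → Valid w (p s) × (∀ u → b s u < 2 ^ suc (p s u))
    loop-invariant (request {s} idle R _ _ x _ x-min as as∈C) =
      fetch-valid s x valid as∈C , b′<2^[1+p′]
      where
      open ≤-Reasoning
      valid = proj₁ (idle-invariant idle)
      b<2^p = proj₂ (idle-invariant idle)
      b′<2^[1+p′] : ∀ y → b (serveRequest s R x as) y < 2 ^ suc (p (fetch s x as) y)
      b′<2^[1+p′] y = case y ≟ x of λ where
        (yes refl) → subst (_< 2 ^ suc (p (fetch s x as) x)) (sym (serveRequest-b-self {s} {R} {x} {as}))
                           (m^n>0 2 (suc (p (fetch s x as) x)))
        (no  y≢x)  → begin-strict
          b (serveRequest s R x as) y ≤⟨ serveRequest-b-≢ {s} {R} {x} {as} y≢x x-min ⟩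
          b s y + 2 ^ p s y            <⟨ +-monoˡ-< (2 ^ p s y) (b<2^p y) ⟩
          2 ^ p s y + 2 ^ p s y        ≡⟨ 2^n+2^n≡2^[1+n] (p s y) ⟩
          2 ^ suc (p s y)              ≤⟨ ^-monoʳ-≤ 2 (s≤s (fetch-p-≥ s x {as} y≢x)) ⟩
          2 ^ suc (p (fetch s x as) y) ∎
    loop-invariant (loop {s} inLoop z _ as as∈C) =
      fetch-valid s z valid as∈C , b′<2^[1+p′]
      where
      valid = proj₁ (loop-invariant inLoop)
      b<2^[1+p] = proj₂ (loop-invariant inLoop)
      b′<2^[1+p′] : ∀ u → b (fetch s z as) u < 2 ^ suc (p (fetch s z as) u)
      b′<2^[1+p′] u = case u ≟ z of λ where
        (yes refl) → subst (_< 2 ^ suc (p (fetch s z as) z)) (sym (fetch-b-self s z as))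
                           (m^n>0 2 (suc (p (fetch s z as) z)))
        (no  u≢z)  → subst (_< 2 ^ suc (p (fetch s z as) u)) (sym (fetch-b-≢ s z {as} u≢z))
                       (<-≤-trans (b<2^[1+p] u) (^-monoʳ-≤ 2 (s≤s (fetch-p-≥ s z {as} u≢z))))

  InLoop⇒1≤r : ∀ {s} → InLoop w r s → 1 ≤ r
  InLoop⇒1≤r (request _ R _ |R|≤r _ x∈R _ _ _) = ≤-trans (nonempty x∈R) |R|≤r
    where
    nonempty : ∀ {x : U w} {xs} → x ∈ xs → 1 ≤ length xs
    nonempty (here  _) = s≤s z≤n
    nonempty (there _) = s≤s z≤n
  InLoop⇒1≤r (loop inLoop _ _ _ _) = InLoop⇒1≤r inLoop

open import Data.Integer as ℤ using (ℤ; +_; _⊖_)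
import Data.Integer.Properties as ℤ
open import Data.Rational.Unnormalised using (0ℚᵘ; *≤*) renaming (_≤_ to _≤ᵘ_)
import Data.Rational.Unnormalised.Properties as ℚᵘ

⊖-+-⊖ : ∀ a b c d → (a ⊖ b) ℤ.+ (c ⊖ d) ≡ (a + c) ⊖ (b + d)
⊖-+-⊖ a b c d = begin
  (a ⊖ b) ℤ.+ (c ⊖ d)            ≡⟨ cong₂ ℤ._+_ (sym (ℤ.[+m]-[+n]≡m⊖n a b)) (sym (ℤ.[+m]-[+n]≡m⊖n c d)) ⟩
  (+ a ℤ.- + b) ℤ.+ (+ c ℤ.- + d) ≡⟨ rearrange (+ a) (+ b) (+ c) (+ d) ⟩
  (+ a ℤ.+ + c) ℤ.- (+ b ℤ.+ + d) ≡⟨ cong₂ ℤ._-_ (sym (ℤ.pos-+ a c)) (sym (ℤ.pos-+ b d)) ⟩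
  + (a + c) ℤ.- + (b + d)         ≡⟨ ℤ.[+m]-[+n]≡m⊖n (a + c) (b + d) ⟩
  (a + c) ⊖ (b + d)               ∎
  where
  open ≡-Reasoning
  open import Data.Integer.Tactic.RingSolver using (solve-∀)
  rearrange : ∀ x y u v → (x ℤ.- y) ℤ.+ (u ℤ.- v) ≡ (x ℤ.+ u) ℤ.- (y ℤ.+ v)
  rearrange = solve-∀

⊖-⊖ : ∀ a b c d → (a ⊖ b) ℤ.- (c ⊖ d) ≡ (a + d) ⊖ (b + c)
⊖-⊖ a b c d = trans (cong (λ t → (a ⊖ b) ℤ.+ t) (sym (ℤ.⊖-swap d c))) (⊖-+-⊖ a b d c)

m+q≤o+n⇒m⊖n≤o⊖q : ∀ m n o q → m + q ≤ o + n → m ⊖ n ℤ.≤ o ⊖ q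
m+q≤o+n⇒m⊖n≤o⊖q m n o q m+q≤o+n = begin
  m ⊖ n             ≡⟨ ℤ.+-cancelˡ-⊖ q m n ⟨
  (q + m) ⊖ (q + n) ≤⟨ ℤ.⊖-monoˡ-≤ (q + n) (≤-trans (≤-reflexive (+-comm q m))
                                             (≤-trans m+q≤o+n (≤-reflexive (+-comm o n)))) ⟩
  (n + o) ⊖ (q + n) ≡⟨ cong ((n + o) ⊖_) (+-comm q n) ⟩
  (n + o) ⊖ (n + q) ≡⟨ ℤ.+-cancelˡ-⊖ n o q ⟩
  o ⊖ q             ∎
  where open ℤ.≤-Reasoning

sumℤ-map-sub : (xs : List A) (f g : A → ℤ) →
             sumℤ (map f xs) ℤ.- sumℤ (map g xs) ≡ sumℤ (map (λ x → f x ℤ.- g x) xs)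
sumℤ-map-sub []       f g = refl
sumℤ-map-sub (x ∷ xs) f g = begin
  (f x ℤ.+ sumℤ (map f xs)) ℤ.- (g x ℤ.+ sumℤ (map g xs))
    ≡⟨ rearrange (f x) (g x) (sumℤ (map f xs)) (sumℤ (map g xs)) ⟩
  (f x ℤ.- g x) ℤ.+ (sumℤ (map f xs) ℤ.- sumℤ (map g xs))
    ≡⟨ cong (λ t → (f x ℤ.- g x) ℤ.+ t) (sumℤ-map-sub xs f g) ⟩
  (f x ℤ.- g x) ℤ.+ sumℤ (map (λ x → f x ℤ.- g x) xs) ∎
  where
  open ≡-Reasoning
  open import Data.Integer.Tactic.RingSolver using (solve-∀)
  rearrange : ∀ a b c d → (a ℤ.+ c) ℤ.- (b ℤ.+ d) ≡ (a ℤ.- b) ℤ.+ (c ℤ.- d)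
  rearrange = solve-∀

sumℤ-mono-≤ : (xs : List A) {f g : A → ℤ} → (∀ x → f x ℤ.≤ g x) → sumℤ (map f xs) ℤ.≤ sumℤ (map g xs)
sumℤ-mono-≤ []       f≤g = ℤ.≤-refl
sumℤ-mono-≤ (x ∷ xs) f≤g = ℤ.+-mono-≤ (f≤g x) (sumℤ-mono-≤ xs f≤g)

sumℤ-map-⊖ : (xs : List A) (m n : A → ℕ) → sumℤ (map (λ x → m x ⊖ n x) xs) ≡ ∑ xs m ⊖ ∑ xs n
sumℤ-map-⊖ []       m n = refl
sumℤ-map-⊖ (x ∷ xs) m n =
  trans (cong (λ t → (m x ⊖ n x) ℤ.+ t) (sumℤ-map-⊖ xs m n)) (⊖-+-⊖ (m x) (n x) (∑ xs m) (∑ xs n))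

mean-≤-0 : (xs : List ℤ) → sumℤ xs ℤ.≤ + 0 → mean xs ≤ᵘ 0ℚᵘ
mean-≤-0 []       _     = ℚᵘ.≤-refl
mean-≤-0 (x ∷ xs) sum≤0 =
  *≤* (subst₂ ℤ._≤_ (sym (ℤ.*-identityʳ (sumℤ (x ∷ xs)))) (sym (ℤ.*-zeroˡ (+ suc (length xs)))) sum≤0)

-- Inside the loop r = 1 + r′ (requests are nonempty), so β and γ are the naturals βℕ and γℕ and
-- every potential difference can be written as m ⊖ n with m, n natural.
module Potential (r′ : ℕ) where

  βℕ γℕ K : ℕ
  βℕ = 10 + 21 * r′
  γℕ = 1 + 7 * r′
  K = κ (suc r′)

  β≡+βℕ : β (suc r′) ≡ + βℕ
  β≡+βℕ = trans (cong (λ n → + n ℤ.- + 11) (*-suc 21 r′))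
              (trans (ℤ.[+m]-[+n]≡m⊖n (11 + βℕ) 11) (ℤ.+-cancelˡ-⊖ 11 βℕ 0))

  γ≡+γℕ : γ (suc r′) ≡ + γℕ
  γ≡+γℕ = trans (cong (λ n → + n ℤ.- + 6) (*-suc 7 r′))
              (trans (ℤ.[+m]-[+n]≡m⊖n (6 + γℕ) 6) (ℤ.+-cancelˡ-⊖ 6 γℕ 0))

  βℕ≤2^K : βℕ ≤ 2 ^ K
  βℕ≤2^K = subst (_≤ 2 ^ K) (trans (cong (_∸ 11) (*-suc 21 r′)) (m+n∸m≡n 11 βℕ))
                 (n≤2^⌈log₂n⌉ (21 * suc r′ ∸ 11))

  φ : (k q c : ℕ) → ℤ
  φ k q c with k ≤? q + K
  ... | yes _ = α ℤ.* + c
  ... | no  _ = β (suc r′) ℤ.* + (2 ^ k) ℤ.- γ (suc r′) ℤ.* + c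

  Φu≡φ : ∀ {w} (pstar : Partition w) (s : State w) u → Φu (suc r′) pstar s u ≡ φ (p s u) (pstar u) (b s u)
  Φu≡φ pstar s u with p s u ≤? pstar u + K
  ... | yes _ = refl
  ... | no  _ = refl

  φ-low : ∀ {k q} c → k ≤ q + K → φ k q c ≡ (7 * c) ⊖ 0
  φ-low {k} {q} c k≤q+K with k ≤? q + K
  ... | yes _     = sym (ℤ.pos-* 7 c)
  ... | no  k≰q+K = contradiction k≤q+K k≰q+K

  φ-high : ∀ {k q} c → ¬ k ≤ q + K → φ k q c ≡ (βℕ * 2 ^ k) ⊖ (γℕ * c)
  φ-high {k} {q} c k≰q+K with k ≤? q + K
  ... | yes k≤q+K = contradiction k≤q+K k≰q+K
  ... | no  _     = begin
    β (suc r′) ℤ.* + (2 ^ k) ℤ.- γ (suc r′) ℤ.* + c ≡⟨ cong₂ (λ x y → x ℤ.* + (2 ^ k) ℤ.- y ℤ.* + c) β≡+βℕ γ≡+γℕ ⟩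
    + βℕ ℤ.* + (2 ^ k) ℤ.- + γℕ ℤ.* + c               ≡⟨ cong₂ ℤ._-_ (ℤ.pos-* βℕ (2 ^ k)) (ℤ.pos-* γℕ c) ⟨
    + (βℕ * 2 ^ k) ℤ.- + (γℕ * c)                     ≡⟨ ℤ.[+m]-[+n]≡m⊖n (βℕ * 2 ^ k) (γℕ * c) ⟩
    (βℕ * 2 ^ k) ⊖ (γℕ * c)                           ∎
    where open ≡-Reasoning

  -- With b z < 2^(ℓ+1), a high element still has potential at least (β - 2γ)·2^ℓ ≥ α·2^ℓ.
  γc+7·2^k≤β·2^k : ∀ {k c} → c < 2 ^ suc k → γℕ * c + 7 * 2 ^ k ≤ βℕ * 2 ^ k
  γc+7·2^k≤β·2^k {k} {c} c<2^[1+k] = begin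
    γℕ * c + 7 * 2 ^ k                ≤⟨ +-monoˡ-≤ (7 * 2 ^ k) (*-monoʳ-≤ γℕ (<⇒≤ c<2^[1+k])) ⟩
    γℕ * (2 * 2 ^ k) + 7 * 2 ^ k      ≡⟨ collect (2 ^ k) r′ ⟩
    (9 + 14 * r′) * 2 ^ k             ≤⟨ *-monoˡ-≤ (2 ^ k) (+-mono-≤ (n≤1+n 9) (*-monoˡ-≤ r′ (m≤m+n 14 7))) ⟩
    βℕ * 2 ^ k                        ∎
    where
    open ≤-Reasoning
    open import Data.Nat.Tactic.RingSolver using (solve-∀)
    collect : ∀ x y → (1 + 7 * y) * (2 * x) + 7 * x ≡ (9 + 14 * y) * x
    collect = solve-∀

  promotionBound : ℕ → ℕ → ℕ
  promotionBound k q = βℕ * 2 ^ suc k * 𝟙 (q + K ≤? k)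

  promotionBound-high : ∀ {k q} → q + K ≤ k → promotionBound k q ≡ βℕ * 2 ^ suc k
  promotionBound-high {k} {q} q+K≤k =
    trans (cong (βℕ * 2 ^ suc k *_) (𝟙-yes (q + K ≤? k) q+K≤k)) (*-identityʳ (βℕ * 2 ^ suc k))

  φ-promote : ∀ k q c → φ (suc k) q c ℤ.- φ k q c ℤ.≤ promotionBound k q ⊖ 0
  φ-promote k q c = promote (suc k ≤? q + K)
    where
    open ℤ.≤-Reasoning
    X = βℕ * 2 ^ suc k
    promote-high : Dec (k ≤ q + K) → (X ⊖ (γℕ * c)) ℤ.- φ k q c ℤ.≤ X ⊖ 0
    promote-high (yes k≤q+K) = begin
      (X ⊖ (γℕ * c)) ℤ.- φ k q c         ≡⟨ cong (λ t → (X ⊖ (γℕ * c)) ℤ.- t) (φ-low c k≤q+K) ⟩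
      (X ⊖ (γℕ * c)) ℤ.- ((7 * c) ⊖ 0)   ≡⟨ ⊖-⊖ X (γℕ * c) (7 * c) 0 ⟩
      (X + 0) ⊖ (γℕ * c + 7 * c)         ≤⟨ m+q≤o+n⇒m⊖n≤o⊖q _ _ X 0 (≤-trans (≤-reflexive (trans (+-identityʳ _) (+-identityʳ X)))
                                                                           (m≤m+n X (γℕ * c + 7 * c))) ⟩
      X ⊖ 0                              ∎
    promote-high (no k≰q+K) = begin
      (X ⊖ (γℕ * c)) ℤ.- φ k q c                     ≡⟨ cong (λ t → (X ⊖ (γℕ * c)) ℤ.- t) (φ-high c k≰q+K) ⟩
      (X ⊖ (γℕ * c)) ℤ.- ((βℕ * 2 ^ k) ⊖ (γℕ * c))   ≡⟨ ⊖-⊖ X (γℕ * c) (βℕ * 2 ^ k) (γℕ * c) ⟩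
      (X + γℕ * c) ⊖ (γℕ * c + βℕ * 2 ^ k)           ≤⟨ m+q≤o+n⇒m⊖n≤o⊖q _ _ X 0 (≤-trans (≤-reflexive (+-identityʳ (X + γℕ * c)))
                                                                                       (+-monoʳ-≤ X (m≤m+n (γℕ * c) (βℕ * 2 ^ k)))) ⟩
      X ⊖ 0                                          ∎
    promote : Dec (suc k ≤ q + K) → φ (suc k) q c ℤ.- φ k q c ℤ.≤ promotionBound k q ⊖ 0
    promote (yes 1+k≤q+K) = begin
      φ (suc k) q c ℤ.- φ k q c          ≡⟨ cong₂ ℤ._-_ (φ-low c 1+k≤q+K) (φ-low c (≤-trans (n≤1+n k) 1+k≤q+K)) ⟩
      ((7 * c) ⊖ 0) ℤ.- ((7 * c) ⊖ 0)    ≡⟨ ℤ.+-inverseʳ ((7 * c) ⊖ 0) ⟩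
      + 0                                ≤⟨ ℤ.+≤+ z≤n ⟩
      promotionBound k q ⊖ 0             ∎
    promote (no 1+k≰q+K) = begin
      φ (suc k) q c ℤ.- φ k q c          ≡⟨ cong (ℤ._- φ k q c) (φ-high c 1+k≰q+K) ⟩
      (X ⊖ (γℕ * c)) ℤ.- φ k q c         ≤⟨ promote-high (k ≤? q + K) ⟩
      X ⊖ 0                              ≡⟨ cong (_⊖ 0) (promotionBound-high (ℕ.s≤s⁻¹ (≰⇒> 1+k≰q+K))) ⟨
      promotionBound k q ⊖ 0             ∎

  φ-reset : ∀ {k q c} q′ → 2 ^ k ≤ c → c < 2 ^ suc k → φ 0 q′ 0 ℤ.- φ k q c ℤ.≤ 0 ⊖ (7 * 2 ^ k)
  φ-reset {k} {q} {c} q′ 2^k≤c c<2^[1+k] = begin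
    φ 0 q′ 0 ℤ.- φ k q c     ≡⟨ cong (ℤ._- φ k q c) (φ-low {0} {q′} 0 z≤n) ⟩
    (0 ⊖ 0) ℤ.- φ k q c      ≤⟨ reset (k ≤? q + K) ⟩
    0 ⊖ (7 * 2 ^ k)          ∎
    where
    open ℤ.≤-Reasoning
    reset : Dec (k ≤ q + K) → (0 ⊖ 0) ℤ.- φ k q c ℤ.≤ 0 ⊖ (7 * 2 ^ k)
    reset (yes k≤q+K) = begin
      (0 ⊖ 0) ℤ.- φ k q c                     ≡⟨ cong (λ t → (0 ⊖ 0) ℤ.- t) (φ-low c k≤q+K) ⟩
      (0 ⊖ 0) ℤ.- ((7 * c) ⊖ 0)               ≡⟨ ⊖-⊖ 0 0 (7 * c) 0 ⟩
      0 ⊖ (7 * c)                             ≤⟨ m+q≤o+n⇒m⊖n≤o⊖q 0 (7 * c) 0 (7 * 2 ^ k) (*-monoʳ-≤ 7 2^k≤c) ⟩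
      0 ⊖ (7 * 2 ^ k)                         ∎
    reset (no k≰q+K) = begin
      (0 ⊖ 0) ℤ.- φ k q c                     ≡⟨ cong (λ t → (0 ⊖ 0) ℤ.- t) (φ-high c k≰q+K) ⟩
      (0 ⊖ 0) ℤ.- ((βℕ * 2 ^ k) ⊖ (γℕ * c))   ≡⟨ ⊖-⊖ 0 0 (βℕ * 2 ^ k) (γℕ * c) ⟩
      (γℕ * c) ⊖ (βℕ * 2 ^ k)                 ≤⟨ m+q≤o+n⇒m⊖n≤o⊖q (γℕ * c) (βℕ * 2 ^ k) 0 (7 * 2 ^ k)
                                                                     (γc+7·2^k≤β·2^k {k} c<2^[1+k]) ⟩
      0 ⊖ (7 * 2 ^ k)                         ∎

  module _ {w : ℕ} (pstar : Partition w) where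

    private
      elements : List (U w)
      elements = allFin (2 ^ w ∸ 1)

    β·#≤2^[1+k] : Valid w pstar → ∀ {k} → k < w → βℕ * ∑ elements (λ u → 𝟙 (pstar u + K ≤? k)) ≤ 2 ^ suc k
    β·#≤2^[1+k] valid* {k} k<w with K ≤? suc k
    ... | yes K≤1+k = begin
      βℕ * ∑ elements (λ u → 𝟙 (pstar u + K ≤? k))  ≤⟨ *-mono-≤ βℕ≤2^K (≤-trans (∑-mono-≤ elements shift)
                                                         (∑𝟙[<m]≤2^m pstar valid* (≤-trans (m∸n≤m (suc k) K) k<w))) ⟩
      2 ^ K * 2 ^ (suc k ∸ K)                       ≡⟨ ^-distribˡ-+-* 2 K (suc k ∸ K) ⟨
      2 ^ (K + (suc k ∸ K))                         ≡⟨ cong (2 ^_) (m+[n∸m]≡n K≤1+k) ⟩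
      2 ^ suc k                                     ∎
      where
      open ≤-Reasoning
      shift : ∀ u → 𝟙 (pstar u + K ≤? k) ≤ 𝟙 (pstar u <? suc k ∸ K)
      shift u = 𝟙-mono (pstar u + K ≤? k) (pstar u <? suc k ∸ K) (λ h → m+n≤o⇒m≤o∸n (suc (pstar u)) (s≤s h))
    ... | no K≰1+k =
      ≤-trans (≤-reflexive (trans (cong (βℕ *_) (trans (∑-cong elements none) (∑-zero elements))) (*-zeroʳ βℕ))) z≤n
      where
      none : ∀ u → 𝟙 (pstar u + K ≤? k) ≡ 0
      none u = 𝟙-no (pstar u + K ≤? k) (λ h → K≰1+k (≤-trans (m≤n+m K (pstar u)) (m≤n⇒m≤1+n h)))

    -- On average over S_k, the promotion bound is at most 4·2^k: only elements whose comparison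
    -- chunk p* is at least κ below k contribute, and there are at most 2^(k+1-κ) ≤ 2^(k+1)/β of them.
    ∑-chunk-promotionBound : Valid w pstar → (q : Partition w) → Valid w q → ∀ {k} → k < w →
      ∑ (chunk {w} q k) (λ u → promotionBound (q u) (pstar u)) ≤ length (chunk {w} q k) * (4 * 2 ^ k)
    ∑-chunk-promotionBound valid* q (_ , |S|≡2^) {k} k<w = begin
      ∑ (chunk {w} q k) (λ u → promotionBound (q u) (pstar u))
        ≤⟨ ∑-filter-≤ (λ u → q u ℕ.≟ k) elements
                      (λ u qu≡k → ≤-reflexive (cong (λ j → promotionBound j (pstar u)) qu≡k)) ⟩
      ∑ elements (λ u → βℕ * 2 ^ suc k * 𝟙 (pstar u + K ≤? k))
        ≡⟨ ∑-*ˡ elements (βℕ * 2 ^ suc k) _ ⟩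
      βℕ * 2 ^ suc k * #
        ≡⟨ regroup βℕ (2 ^ k) # ⟩
      2 ^ suc k * (βℕ * #)
        ≤⟨ *-monoʳ-≤ (2 ^ suc k) (β·#≤2^[1+k] valid* k<w) ⟩
      2 ^ suc k * 2 ^ suc k
        ≡⟨ square (2 ^ k) ⟩
      2 ^ k * (4 * 2 ^ k)
        ≡⟨ cong (_* (4 * 2 ^ k)) (|S|≡2^ k k<w) ⟨
      length (chunk {w} q k) * (4 * 2 ^ k) ∎
      where
      open ≤-Reasoning
      open import Data.Nat.Tactic.RingSolver using (solve-∀)
      # = ∑ elements (λ u → 𝟙 (pstar u + K ≤? k))
      regroup : ∀ b x n → b * (2 * x) * n ≡ 2 * x * (b * n)
      regroup = solve-∀
      square : ∀ x → 2 * x * (2 * x) ≡ x * (4 * x)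
      square = solve-∀

    ∑-choices-promotionBound : Valid w pstar → (q : Partition w) → Valid w q → ∀ {ℓ} → ℓ < w →
      ∑ (choices {w} q ℓ) (λ as → ∑ as (λ a → promotionBound (q a) (pstar a))) ≤ length (choices {w} q ℓ) * (4 * 2 ^ ℓ)
    ∑-choices-promotionBound valid* q valid {ℓ} ℓ<w =
      ∑-choices-∑≤ q _ 4 ℓ (λ i i<ℓ → ∑-chunk-promotionBound valid* q valid (<-trans i<ℓ ℓ<w))

    module _ (s : State w) (z : U w) (2^ℓ≤bz : 2 ^ p s z ≤ b s z) (bz<2^[1+ℓ] : b s z < 2 ^ suc (p s z)) where

      ΔΦu≤ : ∀ as u → Φu (suc r′) pstar (fetch s z as) u ℤ.- Φu (suc r′) pstar s u ℤ.≤
                      (if member {w} u as then promotionBound (p s u) (pstar u) else 0)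
                      ⊖ (if does (u ≟ z) then 7 * 2 ^ p s z else 0)
      ΔΦu≤ as u rewrite Φu≡φ pstar (fetch s z as) u | Φu≡φ pstar s u with u ≟ z
      ... | yes refl = ℤ.≤-trans (φ-reset {p s z} {pstar z} (pstar z) 2^ℓ≤bz bz<2^[1+ℓ])
                                 (ℤ.⊖-monoˡ-≤ (7 * 2 ^ p s z) z≤n)
      ... | no  _ with member {w} u as
      ...   | true  = φ-promote (p s u) (pstar u) (b s u)
      ...   | false = ℤ.≤-reflexive (ℤ.+-inverseʳ (φ (p s u) (pstar u) (b s u)))

      ΔΦ≤ : ∀ as → Φ (suc r′) pstar (fetch s z as) ℤ.- Φ (suc r′) pstar s ℤ.≤
                   ∑ elements (λ u → if member {w} u as then promotionBound (p s u) (pstar u) else 0) ⊖ (7 * 2 ^ p s z)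
      ΔΦ≤ as = begin
        Φ (suc r′) pstar (fetch s z as) ℤ.- Φ (suc r′) pstar s
          ≡⟨ sumℤ-map-sub elements _ _ ⟩
        sumℤ (map (λ u → Φu (suc r′) pstar (fetch s z as) u ℤ.- Φu (suc r′) pstar s u) elements)
          ≤⟨ sumℤ-mono-≤ elements (ΔΦu≤ as) ⟩
        sumℤ (map (λ u → promoted u ⊖ reset u) elements)
          ≡⟨ sumℤ-map-⊖ elements promoted reset ⟩
        ∑ elements promoted ⊖ ∑ elements reset
          ≡⟨ cong (∑ elements promoted ⊖_) (∑-allFin-at _ z (λ _ → 7 * 2 ^ p s z)) ⟩
        ∑ elements promoted ⊖ (7 * 2 ^ p s z) ∎
        where
        open ℤ.≤-Reasoning
        promoted reset : U w → ℕ
        promoted u = if member {w} u as then promotionBound (p s u) (pstar u) else 0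
        reset u = if does (u ≟ z) then 7 * 2 ^ p s z else 0

      deltaFetch≤ : ∀ as → deltaFetch (suc r′) pstar s z as ℤ.≤
                           ∑ as (λ a → promotionBound (p s a) (pstar a)) ⊖ (4 * 2 ^ p s z)
      deltaFetch≤ as = begin
        + movementCost ℓ ℤ.+ (Φ (suc r′) pstar (fetch s z as) ℤ.- Φ (suc r′) pstar s)
          ≤⟨ ℤ.+-monoʳ-≤ (+ movementCost ℓ) (ΔΦ≤ as) ⟩
        (movementCost ℓ ⊖ 0) ℤ.+ (∑ elements promoted ⊖ (7 * 2 ^ ℓ))
          ≡⟨ ⊖-+-⊖ (movementCost ℓ) 0 (∑ elements promoted) (7 * 2 ^ ℓ) ⟩
        (movementCost ℓ + ∑ elements promoted) ⊖ (7 * 2 ^ ℓ)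
          ≤⟨ m+q≤o+n⇒m⊖n≤o⊖q _ _ (∑ as f) (4 * 2 ^ ℓ) cost≤ ⟩
        ∑ as f ⊖ (4 * 2 ^ ℓ) ∎
        where
        open ℤ.≤-Reasoning
        open import Data.Nat.Tactic.RingSolver using (solve-∀)
        ℓ = p s z
        f : U w → ℕ
        f a = promotionBound (p s a) (pstar a)
        promoted : U w → ℕ
        promoted u = if member {w} u as then f u else 0
        collect : ∀ x y → 3 * x + y + 4 * x ≡ y + 7 * x
        collect = solve-∀
        cost≤ : movementCost ℓ + ∑ elements promoted + 4 * 2 ^ ℓ ≤ ∑ as f + 7 * 2 ^ ℓ
        cost≤ = ≤-trans (+-monoˡ-≤ (4 * 2 ^ ℓ) (+-mono-≤ (movementCost≤3*2^ℓ ℓ) (∑-member-≤ {w} f as)))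
                        (≤-reflexive (collect (2 ^ ℓ) (∑ as f)))

      expectedDelta≤0 : Valid w pstar → Valid w (p s) → expectedDelta (suc r′) pstar s z ≤ᵘ 0ℚᵘ
      expectedDelta≤0 valid* valid = mean-≤-0 (map (deltaFetch (suc r′) pstar s z) C) (begin
        sumℤ (map (deltaFetch (suc r′) pstar s z) C)     ≤⟨ sumℤ-mono-≤ C deltaFetch≤ ⟩
        sumℤ (map (λ as → ∑ as f ⊖ (4 * 2 ^ ℓ)) C)       ≡⟨ sumℤ-map-⊖ C (λ as → ∑ as f) (λ _ → 4 * 2 ^ ℓ) ⟩
        ∑ C (λ as → ∑ as f) ⊖ ∑ C (λ _ → 4 * 2 ^ ℓ)      ≤⟨ m+q≤o+n⇒m⊖n≤o⊖q _ _ 0 0 average≤ ⟩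
        + 0                                              ∎)
        where
        open ℤ.≤-Reasoning
        ℓ = p s z
        C = choices {w} (p s) ℓ
        f : U w → ℕ
        f a = promotionBound (p s a) (pstar a)
        average≤ : ∑ C (λ as → ∑ as f) + 0 ≤ ∑ C (λ _ → 4 * 2 ^ ℓ)
        average≤ = ≤-trans (≤-reflexive (+-identityʳ _))
                           (≤-trans (∑-choices-promotionBound valid* (p s) valid (proj₁ valid z))
                                    (≤-reflexive (sym (∑-const C (4 * 2 ^ ℓ)))))

lemma6 : (w r : ℕ) (pstar : Partition w) → Valid w pstar →
         (s : State w) → InLoop w r s →
         (z : U w) → 2 ^ p s z ≤ b s z →
         expectedDelta r pstar s z ≤ᵘ 0ℚᵘ
lemma6 w zero       pstar valid* s inLoop z 2^ℓ≤bz = contradiction (InLoop⇒1≤r inLoop) λ ()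
lemma6 w (suc r′) pstar valid* s inLoop z 2^ℓ≤bz =
  Potential.expectedDelta≤0 r′ pstar s z 2^ℓ≤bz (b<2^[1+p] z) valid* valid
  where
  valid = proj₁ (loop-invariant inLoop)
  b<2^[1+p] = proj₂ (loop-invariant inLoop)
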